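{- Let $l\ge 1$ be an integer, let $G$ be a graph and let $v$ be a vertex of $G$. If $\beta(G,v)=1$, then there is a minimum size $l$-path vertex cover $S$ of $G$ such that $v\notin S$.
   Context: All graphs are finite, simple and undirected. An $l$-path is a simple path with exactly $l$ vertices; $V(P)$ denotes the vertex set of a path $P$. An $l$-path vertex cover of $G$ is a set $S$ of vertices such that $G-S$ (the subgraph of $G$ induced by $V(G)\setminus S$) contains no $l$-path. For a vertex $v$, $C_v$ is the vertex set of the connected component of $G$ containing $v$. A $v$-path is an $l$-path containing $v$. A $v$-hitting set is a set $X\subseteq C_v\setminus\{v\}$ such that $X\cap V(P)\neq\emptyset$ for every $v$-path $P$. $\beta(G,v)$ denotes the minimum size of a $v$-hitting set in $G$. -}

module Defs where

open import Data.Nat using (ℕ; _≤_)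
open import Data.Bool using (Bool; true; false)
open import Data.Fin using (Fin)
open import Data.Fin.Subset using (Subset; _∈_; _∉_; ∣_∣)
open import Data.List using (List; length)
open import Data.List.Relation.Unary.All using (All)
open import Data.List.Relation.Unary.Unique.Propositional using (Unique)
open import Data.List.Relation.Unary.Linked using (Linked)
import Data.List.Membership.Propositional as LM
open import Data.Product using (Σ; _×_; ∃)
open import Relation.Binary.PropositionalEquality using (_≡_; _≢_)
open import Relation.Nullary using (¬_)

record Graph (n : ℕ) : Set where
  field
    adj     : Fin n → Fin n → Bool
    symm    : ∀ u w → adj u w ≡ adj w u
    irrefl  : ∀ u → adj u u ≡ false

open Graph public

Adj : ∀ {n} → Graph n → Fin n → Fin n → Set
Adj G u w = adj G u w ≡ true

record Path {n} (G : Graph n) (l : ℕ) : Set where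
  field
    verts    : List (Fin n)
    len      : length verts ≡ l
    distinct : Unique verts
    linked   : Linked (Adj G) verts

open Path public

OnPath : ∀ {n} {G : Graph n} {l} → Fin n → Path G l → Set
OnPath u P = u LM.∈ verts P

IsPathCover : ∀ {n} → Graph n → ℕ → Subset n → Set
IsPathCover G l S = ¬ (Σ (Path G l) λ P → All (λ u → u ∉ S) (verts P))

IsMinPathCover : ∀ {n} → Graph n → ℕ → Subset n → Set
IsMinPathCover G l S =
  IsPathCover G l S × (∀ T → IsPathCover G l T → ∣ S ∣ ≤ ∣ T ∣)

data Reach {n} (G : Graph n) (v : Fin n) : Fin n → Set where
  here : Reach G v v
  step : ∀ {u w} → Reach G v u → Adj G u w → Reach G v w

IsHitting : ∀ {n} → Graph n → ℕ → Fin n → Subset n → Set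
IsHitting G l v X =
  (∀ u → u ∈ X → Reach G v u × u ≢ v) ×
  (∀ (P : Path G l) → OnPath v P → ∃ λ u → OnPath u P × u ∈ X)

-- β(G,v) = b : b is the minimum size of a v-hitting set.
Beta≡ : ∀ {n} → Graph n → ℕ → Fin n → ℕ → Set
Beta≡ G l v b =
  (∃ λ X → IsHitting G l v X × ∣ X ∣ ≡ b) ×
  (∀ X → IsHitting G l v X → b ≤ ∣ X ∣)

-- Take any minimum cover S. If v ∈ S, let X = {x} be a v-hitting set and
-- replace v by x: paths avoiding v are still hit by S - v and paths through
-- v are hit by x, so (S - v) ∪ X is a cover of size at most |S|, hence
-- minimum, and it avoids v because x ≠ v.  Minimum covers exist since
-- being a cover is decidable (an l-path is a list over the finite vertex
-- set) and the full vertex set is a cover once l ≥ 1.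

module Submission where

open import Defs
open import Data.Nat using (ℕ; _≤_)
open import Data.Fin using (Fin)
open import Data.Fin.Subset using (Subset; _∉_)
open import Data.Product using (∃; _×_)

open import Level using (Level)
open import Data.Nat using (zero; suc; _+_; _<_; z≤n; s≤s; _≤?_)
open import Data.Nat.Properties
  using (≤-refl; ≤-trans; ≤-reflexive; ≤-pred; +-suc; +-comm; +-monoˡ-≤; m≤n⇒m≤1+n; ≰⇒>; suc-injective)
open Data.Nat.Properties.≤-Reasoning
open import Data.Fin using (zero; suc; _≟_)
open import Data.Fin.Properties using (any?)
open import Data.Fin.Subset using (_∈_; _∪_; _-_; ⊤; ∣_∣; inside; outside)
open import Data.Fin.Subset.Properties
  using (_∈?_; anySubset?; ∈⊤; x∈p∪q⁺; x∈p∪q⁻; x∈p∧x≢y⇒x∈p-y; x∈p⇒∣p-x∣<∣p∣)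
open import Data.Bool using (true) renaming (_≟_ to _≟ᵇ_)
open import Data.Vec using ([]; _∷_; there)
open import Data.List using (List; []; _∷_; length)
open import Data.List.Relation.Unary.All as All using (All; _∷_)
open import Data.List.Relation.Unary.Linked using (Linked; linked?)
open import Data.List.Relation.Unary.Unique.Propositional using (Unique)
open import Data.List.Membership.Propositional using () renaming (_∈_ to _∈ₗ_)
open import Data.Product using (_,_; proj₂)
open import Data.Sum using (inj₁; inj₂)
open import Relation.Nullary using (Dec; yes; no; ¬?)
open import Relation.Nullary.Decidable using (_×-dec_)
open import Relation.Unary using (Pred; Decidable)
open import Relation.Binary.PropositionalEquality using (_≡_; _≢_; refl; cong; sym; subst)

private
  variable
    ℓ : Level
    n : ℕ

∃-list-of-length? : {P : Pred (List (Fin n)) ℓ} → Decidable P →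
  ∀ l → Dec (∃ λ xs → length xs ≡ l × P xs)
∃-list-of-length? P? zero with P? []
... | yes P[] = yes ([] , refl , P[])
... | no ¬P[] = no λ { ([] , refl , P[]) → ¬P[] P[] }
∃-list-of-length? P? (suc l) with any? (λ x → ∃-list-of-length? (λ xs → P? (x ∷ xs)) l)
... | yes (x , xs , ∣xs∣≡l , Pxxs) = yes (x ∷ xs , cong suc ∣xs∣≡l , Pxxs)
... | no ∄ = no λ { (x ∷ xs , ∣xxs∣≡sl , Pxxs) → ∄ (x , xs , suc-injective ∣xxs∣≡sl , Pxxs) }

∃-minimum-size : {P : Pred (Subset n) ℓ} → Decidable P → ∀ {S} → P S →
  ∃ λ T → P T × (∀ U → P U → ∣ T ∣ ≤ ∣ U ∣)
∃-minimum-size {P = P} P? PS = descend _ PS ≤-refl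
  where
  descend : ∀ k {S} → P S → ∣ S ∣ ≤ k → ∃ λ T → P T × (∀ U → P U → ∣ T ∣ ≤ ∣ U ∣)
  descend zero {S} PS ∣S∣≤0 = S , PS , λ _ _ → ≤-trans ∣S∣≤0 z≤n
  descend (suc k) {S} PS ∣S∣≤1+k with anySubset? (λ T → P? T ×-dec (∣ T ∣ ≤? k))
  ... | yes (T , PT , ∣T∣≤k) = descend k PT ∣T∣≤k
  ... | no ∄ = S , PS , λ U PU → ≤-trans ∣S∣≤1+k (≰⇒> λ ∣U∣≤k → ∄ (U , PU , ∣U∣≤k))

∣p∪q∣≤∣p∣+∣q∣ : ∀ (p q : Subset n) → ∣ p ∪ q ∣ ≤ ∣ p ∣ + ∣ q ∣
∣p∪q∣≤∣p∣+∣q∣ []            []            = z≤n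
∣p∪q∣≤∣p∣+∣q∣ (outside ∷ p) (outside ∷ q) = ∣p∪q∣≤∣p∣+∣q∣ p q
∣p∪q∣≤∣p∣+∣q∣ (inside  ∷ p) (outside ∷ q) = s≤s (∣p∪q∣≤∣p∣+∣q∣ p q)
∣p∪q∣≤∣p∣+∣q∣ (outside ∷ p) (inside  ∷ q) =
  ≤-trans (s≤s (∣p∪q∣≤∣p∣+∣q∣ p q)) (≤-reflexive (sym (+-suc ∣ p ∣ ∣ q ∣)))
∣p∪q∣≤∣p∣+∣q∣ (inside  ∷ p) (inside  ∷ q) =
  s≤s (≤-trans (m≤n⇒m≤1+n (∣p∪q∣≤∣p∣+∣q∣ p q)) (≤-reflexive (sym (+-suc ∣ p ∣ ∣ q ∣))))

∣p-x∪q∣<∣p∣+∣q∣ : ∀ {x} (p q : Subset n) → x ∈ p → ∣ (p - x) ∪ q ∣ < ∣ p ∣ + ∣ q ∣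
∣p-x∪q∣<∣p∣+∣q∣ {x = x} p q x∈p =
  ≤-trans (s≤s (∣p∪q∣≤∣p∣+∣q∣ (p - x) q)) (+-monoˡ-≤ ∣ q ∣ (x∈p⇒∣p-x∣<∣p∣ x∈p))

x∉p-x : ∀ (p : Subset n) x → x ∉ p - x
x∉p-x (outside ∷ p) zero    ()
x∉p-x (inside  ∷ p) zero    ()
x∉p-x (_       ∷ p) (suc x) (there x∈p-x) = x∉p-x p x x∈p-x

x∉q⇒x∉p-x∪q : ∀ {x} (p q : Subset n) → x ∉ q → x ∉ (p - x) ∪ q
x∉q⇒x∉p-x∪q {x = x} p q x∉q x∈ with x∈p∪q⁻ (p - x) q x∈
... | inj₁ x∈p-x = x∉p-x p x x∈p-x
... | inj₂ x∈q   = x∉q x∈q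

module _ (G : Graph n) (l : ℕ) where

  open import Data.List.Relation.Unary.Unique.DecPropositional (_≟_ {n}) using (unique?)
  open import Data.List.Membership.DecPropositional (_≟_ {n}) using () renaming (_∈?_ to _∈ₗ?_)

  AvoidingPath : Subset n → Pred (List (Fin n)) _
  AvoidingPath S xs = Unique xs × Linked (Adj G) xs × All (_∉ S) xs

  avoidingPath? : ∀ S → Decidable (AvoidingPath S)
  avoidingPath? S xs =
    unique? xs ×-dec linked? (λ u w → adj G u w ≟ᵇ true) xs ×-dec All.all? (λ u → ¬? (u ∈? S)) xs

  isPathCover? : Decidable (IsPathCover G l)
  isPathCover? S with ∃-list-of-length? (avoidingPath? S) l
  ... | yes (xs , ∣xs∣≡l , unique , linked , avoids) =
    no λ cover → cover (record { verts = xs ; len = ∣xs∣≡l ; distinct = unique ; linked = linked } , avoids)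
  ... | no ∄ = yes λ { (P , avoids) → ∄ (verts P , len P , distinct P , linked P , avoids) }

  ⊤-isPathCover : 1 ≤ l → IsPathCover G l ⊤
  ⊤-isPathCover 1≤l (P , avoids) with verts P | len P | avoids
  ... | []    | refl | _          with () ← 1≤l
  ... | _ ∷ _ | _    | u∉⊤ ∷ _    = u∉⊤ ∈⊤

  ∃-minPathCover : 1 ≤ l → ∃ (IsMinPathCover G l)
  ∃-minPathCover 1≤l = ∃-minimum-size isPathCover? (⊤-isPathCover 1≤l)

  HitsEveryPathThrough : Fin n → Subset n → Set
  HitsEveryPathThrough v X = ∀ (P : Path G l) → OnPath v P → ∃ λ u → OnPath u P × u ∈ X

  isPathCover-exchange : ∀ {S X v} → IsPathCover G l S → HitsEveryPathThrough v X →
    IsPathCover G l ((S - v) ∪ X)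
  isPathCover-exchange {S} {X} {v} cover hits (P , avoids) with v ∈ₗ? verts P
  ... | yes v∈P = let (u , u∈P , u∈X) = hits P v∈P in All.lookup avoids u∈P (x∈p∪q⁺ (inj₂ u∈X))
  ... | no  v∉P = cover (P , All.tabulate avoidsS)
    where
    avoidsS : ∀ {u} → u ∈ₗ verts P → u ∉ S
    avoidsS {u} u∈P u∈S = All.lookup avoids u∈P (x∈p∪q⁺ (inj₁ (x∈p∧x≢y⇒x∈p-y u∈S u≢v)))
      where
      u≢v : u ≢ v
      u≢v refl = v∉P u∈P

  isMinPathCover-exchange : ∀ {S X v} → IsMinPathCover G l S → v ∈ S →
    HitsEveryPathThrough v X → ∣ X ∣ ≡ 1 → IsMinPathCover G l ((S - v) ∪ X)
  isMinPathCover-exchange {S} {X} {v} (cover , minimum) v∈S hits ∣X∣≡1 =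
    isPathCover-exchange cover hits , λ T coverT → ≤-trans ∣S'∣≤∣S∣ (minimum T coverT)
    where
    ∣S'∣≤∣S∣ : ∣ (S - v) ∪ X ∣ ≤ ∣ S ∣
    ∣S'∣≤∣S∣ = ≤-pred (begin-strict
      ∣ (S - v) ∪ X ∣ <⟨ ∣p-x∪q∣<∣p∣+∣q∣ S X v∈S ⟩
      ∣ S ∣ + ∣ X ∣   ≡⟨ cong (∣ S ∣ +_) ∣X∣≡1 ⟩
      ∣ S ∣ + 1       ≡⟨ +-comm ∣ S ∣ 1 ⟩
      suc ∣ S ∣       ∎)

corollary1 : (l : ℕ) → 1 ≤ l → {n : ℕ} → (G : Graph n) → (v : Fin n) →
    Beta≡ G l v 1 → ∃ λ (S : Subset n) → IsMinPathCover G l S × v ∉ S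
corollary1 l 1≤l G v ((X , (X⊆Cv∖v , hits) , ∣X∣≡1) , _) with ∃-minPathCover G l 1≤l
... | S , minS with v ∈? S
... | no  v∉S = S , minS , v∉S
... | yes v∈S = (S - v) ∪ X
              , isMinPathCover-exchange G l minS v∈S hits ∣X∣≡1
              , x∉q⇒x∉p-x∪q S X (λ v∈X → proj₂ (X⊆Cv∖v v v∈X) refl)
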